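{- Let $n\ge1$ and $k\ge0$ be integers with $3k+2\le n$. Then Alice wins the feedback game on $E_n$ with starting vertex $u_{3k+2}$.
   Context: The octahedral path $E_n$ ($n\ge1$) is the graph on vertices $u_i,v_i,w_i$ ($0\le i\le n$) whose edges are: $u_iv_i, v_iw_i, w_iu_i$ for $0\le i\le n$, and $u_iu_{i+1}, u_iw_{i+1}, v_iv_{i+1}, v_iu_{i+1}, w_iw_{i+1}, w_iv_{i+1}$ for $0\le i\le n-1$; the game with starting vertex $u_p$, $v_p$ or $w_p$ are equivalent by symmetry. The feedback game on a connected graph $G$ with a starting vertex $s$: a token is placed on $s$; two players, Alice (who moves first) and Bob, alternately move the token from its current vertex $u$ to a vertex $v$ adjacent to $u$, and the edge $uv$ is then deleted. The first player who moves the token back to $s$, or to a vertex that is isolated after deletion of the edge just used, wins. "X wins the game" means X has a winning strategy. -}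

module Defs where

open import Data.Bool using (Bool; true; false; _∧_; _∨_; not; T)
open import Data.Nat using (ℕ; zero; suc; _≡ᵇ_; _<_)
open import Data.Fin using (Fin; zero; suc; toℕ; fromℕ<)
open import Data.Product using (_×_; _,_)
open import Data.Sum using (_⊎_)
open import Relation.Nullary using (¬_; Dec; yes; no)
open import Relation.Binary.PropositionalEquality using (_≡_)
open import Relation.Binary.Definitions using (DecidableEquality)

-- The feedback game on an arbitrary (finite, simple, undirected) graph.
-- A graph state is a Boolean edge relation  E : V → V → Bool
-- (assumed symmetric; the octahedral path below is symmetric).

module FeedbackGame {V : Set} (_≟_ : DecidableEquality V) (s : V) where

  eqᵇ : V → V → Bool
  eqᵇ x y with x ≟ y
  ... | yes _ = true
  ... | no  _ = false

  del : (V → V → Bool) → V → V → (V → V → Bool)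
  del E x y a b = E a b ∧ not ((eqᵇ a x ∧ eqᵇ b y) ∨ (eqᵇ a y ∧ eqᵇ b x))

  Isolated : (V → V → Bool) → V → Set
  Isolated E v = ∀ w → ¬ T (E v w)

  -- the mover who just moved the token to v (with resulting edge set E) wins
  Terminal : (V → V → Bool) → V → Set
  Terminal E v = v ≡ s ⊎ Isolated E v

  mutual
    -- the player to move, with the token on u and remaining edges E,
    -- has a winning strategy
    data Win (E : V → V → Bool) (u : V) : Set where
      win : (v : V) → T (E u v) →
            Terminal (del E u v) v ⊎ Lose (del E u v) v → Win E u

    data Lose (E : V → V → Bool) (u : V) : Set where
      lose : ((w : V) → T (E u w) →
                ¬ Terminal (del E u w) w × Win (del E u w) w) → Lose E u

  AliceWins : (V → V → Bool) → Set
  AliceWins G = Win G s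

-- The octahedral path E_n.  Vertex (c , i) with c ∈ Fin 3 and
-- i ∈ {0..n}: c = 0 is u_i, c = 1 is v_i, c = 2 is w_i.

OVertex : ℕ → Set
OVertex n = Fin 3 × Fin (suc n)

finEqᵇ : ∀ {m} → Fin m → Fin m → Bool
finEqᵇ a b = toℕ a ≡ᵇ toℕ b

-- cross a b : is (a at layer i) adjacent to (b at layer i+1)?
-- edges u_i u_{i+1}, u_i w_{i+1}, v_i v_{i+1}, v_i u_{i+1},
--       w_i w_{i+1}, w_i v_{i+1}
cross : Fin 3 → Fin 3 → Bool
cross zero zero = true
cross zero (suc zero) = false
cross zero (suc (suc zero)) = true
cross (suc zero) zero = true
cross (suc zero) (suc zero) = true
cross (suc zero) (suc (suc zero)) = false
cross (suc (suc zero)) zero = false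
cross (suc (suc zero)) (suc zero) = true
cross (suc (suc zero)) (suc (suc zero)) = true

octaEdge : (n : ℕ) → OVertex n → OVertex n → Bool
octaEdge n (a , i) (b , j) =
     (finEqᵇ i j ∧ not (finEqᵇ a b))
  ∨ ((suc (toℕ i) ≡ᵇ toℕ j) ∧ cross a b)
  ∨ ((suc (toℕ j) ≡ᵇ toℕ i) ∧ cross b a)

_≟V_ : ∀ {n} → DecidableEquality (OVertex n)
(a , i) ≟V (b , j) with a Data.Fin.≟ b | i Data.Fin.≟ j
... | yes Relation.Binary.PropositionalEquality.refl | yes Relation.Binary.PropositionalEquality.refl = yes Relation.Binary.PropositionalEquality.refl
... | no ¬p | _ = no (λ { Relation.Binary.PropositionalEquality.refl → ¬p Relation.Binary.PropositionalEquality.refl })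
... | yes _ | no ¬q = no (λ { Relation.Binary.PropositionalEquality.refl → ¬q Relation.Binary.PropositionalEquality.refl })

uVertex : (n p : ℕ) → p < suc n → OVertex n
uVertex n p h = (zero , fromℕ< h)

AliceWinsOcta : (n : ℕ) → OVertex n → Set
AliceWinsOcta n x = FeedbackGame.AliceWins (_≟V_ {n}) x (octaEdge n)

module Submission where

-- Put Q = 3k+1.  Alice first moves to u_Q.  From then on Bob is always to
-- move at a "trap": u_ℓ with ℓ ≡ 1 or w_ℓ with ℓ ≡ 0 (mod 3), ℓ ≤ Q.  The
-- traps w₀ u₁ w₃ u₄ … w_{Q-1} u_Q form a chain, they are pairwise
-- non-adjacent, and every other vertex of level ≤ Q (a "relay") is
-- adjacent to exactly two consecutive traps.  So whenever Bob moves from a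
-- trap to a relay, Alice moves on to the other trap adjacent to it (its
-- "partner"); the only other move from a trap is u_Q → w_{Q+1}, after
-- which Alice moves to s and wins.  Since the partner map is an
-- involution, Alice's answers never use an edge that was already deleted.

open import Data.Bool using (Bool; true; false; _∧_; _∨_; not; T; if_then_else_)
open import Data.Bool.Properties using (T-∧; T-∨; T-≡; T-not-≡)
open import Data.Empty using (⊥; ⊥-elim)
open import Data.Fin using (Fin; zero; suc; toℕ; fromℕ<)
open import Data.Fin.Properties using (toℕ-injective; toℕ-fromℕ<; fromℕ<-toℕ; toℕ<n)
open import Data.List using (List; []; _∷_; map; cartesianProduct; allFin)
open import Data.List.Membership.Propositional using (_∈_)
open import Data.List.Membership.Propositional.Properties using (∈-cartesianProduct⁺; ∈-allFin)
open import Data.List.Relation.Unary.Any using (here; there)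
open import Data.Nat using (ℕ; zero; suc; _+_; _*_; _∸_; _≤_; _<_; _≡ᵇ_; _<?_; z≤n; s≤s)
open import Data.Nat.ListAction using (sum)
open import Data.Nat.Properties
  using (≤-refl; ≤-trans; ≤-<-trans; <-≤-trans; n≤1+n; 1+n≰n; ≤∧≢⇒<; m≤n⇒m<n∨m≡n;
         +-mono-≤; +-mono-<-≤; +-mono-≤-<; +-comm; *-suc; m≢1+n+m; 1+n≢n; ≡ᵇ⇒≡; ≡⇒≡ᵇ)
open import Data.Product using (_×_; _,_; proj₁; proj₂)
open import Data.Sum using (_⊎_; inj₁; inj₂; [_,_])
open import Function using (_∘_)
open import Function.Bundles using (Equivalence)
open import Relation.Nullary using (¬_; yes; no)
open import Relation.Binary.PropositionalEquality
  using (_≡_; _≢_; refl; sym; trans; cong; subst; ≢-sym; module ≡-Reasoning)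
open import Relation.Binary.Definitions using (DecidableEquality)
open import Defs

open Equivalence using (to; from)

sum-map-mono : ∀ {A : Set} (f g : A → ℕ) (xs : List A) →
               (∀ x → f x ≤ g x) → sum (map f xs) ≤ sum (map g xs)
sum-map-mono f g []       f≤g = z≤n
sum-map-mono f g (x ∷ xs) f≤g = +-mono-≤ (f≤g x) (sum-map-mono f g xs f≤g)

sum-map-strict : ∀ {A : Set} (f g : A → ℕ) (xs : List A) →
                 (∀ x → f x ≤ g x) → ∀ {x} → x ∈ xs → f x < g x →
                 sum (map f xs) < sum (map g xs)
sum-map-strict f g (x ∷ xs) f≤g (here refl)  fx<gx =
  +-mono-<-≤ fx<gx (sum-map-mono f g xs f≤g)
sum-map-strict f g (y ∷ xs) f≤g (there x∈xs) fx<gx =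
  +-mono-≤-< (f≤g y) (sum-map-strict f g xs f≤g x∈xs fx<gx)

indicator : Bool → ℕ
indicator true  = 1
indicator false = 0

indicator-mono : ∀ {p q} → (T p → T q) → indicator p ≤ indicator q
indicator-mono {false}          _   = z≤n
indicator-mono {true}  {true}   _   = ≤-refl
indicator-mono {true}  {false} p⇒q = ⊥-elim (p⇒q _)

indicator-strict : ∀ {p q} → ¬ T p → T q → indicator p < indicator q
indicator-strict {false} {true} _ _ = s≤s z≤n
indicator-strict {true}  ¬p _ = ⊥-elim (¬p _)

T-not : ∀ {b} → ¬ T b → T (not b)
T-not {false} _  = _
T-not {true}  ¬b = ¬b _

T-not⁻¹ : ∀ {b} → T (not b) → ¬ T b
T-not⁻¹ {false} _ ()

module PairingStrategy {V : Set} (_≟_ : DecidableEquality V) (s : V) where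

  open FeedbackGame _≟_ s

  Graph : Set
  Graph = V → V → Bool

  eqᵇ-sound : ∀ {x y} → T (eqᵇ x y) → x ≡ y
  eqᵇ-sound {x} {y} t with x ≟ y
  ... | yes x≡y = x≡y

  eqᵇ-complete : ∀ {x y} → x ≡ y → T (eqᵇ x y)
  eqᵇ-complete {x} {y} x≡y with x ≟ y
  ... | yes _   = _
  ... | no x≢y = x≢y x≡y

  SameEdge : V → V → V → V → Set
  SameEdge x y a b = (a ≡ x × b ≡ y) ⊎ (a ≡ y × b ≡ x)

  del-sub : ∀ E x y {a b} → T (del E x y a b) → T (E a b)
  del-sub E x y t = proj₁ (to T-∧ t)

  del-gone : ∀ E x y {a b} → SameEdge x y a b → ¬ T (del E x y a b)
  del-gone E x y {a} {b} same t =
    T-not⁻¹ (proj₂ (to (T-∧ {E a b}) t)) (from T-∨ (same-test same))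
    where
    same-test : SameEdge x y a b → T (eqᵇ a x ∧ eqᵇ b y) ⊎ T (eqᵇ a y ∧ eqᵇ b x)
    same-test (inj₁ (a≡x , b≡y)) = inj₁ (from T-∧ (eqᵇ-complete a≡x , eqᵇ-complete b≡y))
    same-test (inj₂ (a≡y , b≡x)) = inj₂ (from T-∧ (eqᵇ-complete a≡y , eqᵇ-complete b≡x))

  del-keep : ∀ E x y {a b} → T (E a b) → ¬ SameEdge x y a b → T (del E x y a b)
  del-keep E x y {a} {b} t ¬same = from (T-∧ {E a b}) (t , T-not different)
    where
    sound : ∀ {p q r u} → T (eqᵇ p q ∧ eqᵇ r u) → p ≡ q × r ≡ u
    sound t′ = let (e₁ , e₂) = to T-∧ t′ in eqᵇ-sound e₁ , eqᵇ-sound e₂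
    different : ¬ T ((eqᵇ a x ∧ eqᵇ b y) ∨ (eqᵇ a y ∧ eqᵇ b x))
    different t′ with to T-∨ t′
    ... | inj₁ t₁ = ¬same (inj₁ (sound t₁))
    ... | inj₂ t₂ = ¬same (inj₂ (sound t₂))

  del-keep-avoiding : ∀ (P : V → Set) E x y {a b} → P x ⊎ P y → ¬ P a → ¬ P b →
                      T (E a b) → T (del E x y a b)
  del-keep-avoiding P E x y Pxy ¬Pa ¬Pb t = del-keep E x y t λ where
    (inj₁ (refl , refl)) → [ ¬Pa , ¬Pb ] Pxy
    (inj₂ (refl , refl)) → [ ¬Pb , ¬Pa ] Pxy

  -- The number of (ordered) edges of a graph state, over an enumeration
  -- of the vertices; it strictly decreases when an edge is deleted, which
  -- makes it a termination measure for the game.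
  module EdgeCount (vertices : List V) (complete : ∀ v → v ∈ vertices) where

    edgeCount : Graph → ℕ
    edgeCount E =
      sum (map (λ x → sum (map (λ y → indicator (E x y)) vertices)) vertices)

    edgeCount-mono : ∀ E E′ → (∀ {a b} → T (E′ a b) → T (E a b)) →
                     edgeCount E′ ≤ edgeCount E
    edgeCount-mono E E′ E′⊆E =
      sum-map-mono _ _ vertices λ x → sum-map-mono _ _ vertices λ y → indicator-mono E′⊆E

    edgeCount-del : ∀ E x y → T (E x y) → edgeCount (del E x y) < edgeCount E
    edgeCount-del E x y t =
      sum-map-strict _ _ vertices
        (λ a → sum-map-mono _ _ vertices λ b → indicator-mono (del-sub E x y))
        (complete x)
        (sum-map-strict _ _ vertices (λ b → indicator-mono (del-sub E x y)) (complete y)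
          (indicator-strict (del-gone E x y (inj₁ (refl , refl))) t))

    -- A pairing strategy against the player who is to move at the trap
    -- vertices.  Since `partner y` is
    -- an involution, answering never destroys the edges needed later.
    module Strategy (Trap Relay Finish : V → Set) (partner : V → V → V)
                    (s∉Trap : ¬ Trap s)
                    (Finish∉Trap : ∀ {d} → Finish d → ¬ Trap d)
                    (Relay∉Trap : ∀ {y} → Relay y → ¬ Trap y) where

      record Invariant (E : Graph) : Set where
        field
          trap-move : ∀ {a y} → Trap a → T (E a y) → y ≢ s × (Finish y ⊎ Relay y)
          relay-answer : ∀ {y a} → Relay y → Trap a → T (E a y) →
                         Trap (partner y a) × partner y (partner y a) ≡ a ×
                         partner y a ≢ a × T (E y (partner y a))
          finish-open : ∀ {d} → Finish d → T (E d s)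
      open Invariant

      invariant-step : ∀ {E a₀ y₀} → Invariant E → Trap a₀ → Relay y₀ → T (E a₀ y₀) →
                       Invariant (del (del E a₀ y₀) y₀ (partner y₀ a₀))
      invariant-step {E} {a₀} {y₀} inv a₀-trap y₀-relay a₀y₀ = record
        { trap-move    = λ a-trap t → trap-move inv a-trap (shrinks t)
        ; relay-answer = answer
        ; finish-open  = λ d-fin →
            del-keep-avoiding Trap E₁ y₀ a₁ (inj₂ a₁-trap) (Finish∉Trap d-fin) s∉Trap
              (del-keep-avoiding Trap E a₀ y₀ (inj₁ a₀-trap) (Finish∉Trap d-fin) s∉Trap
                (finish-open inv d-fin))
        }
        where
        a₁ = partner y₀ a₀
        E₁ = del E a₀ y₀
        E₂ = del E₁ y₀ a₁
        a₀-answer = relay-answer inv y₀-relay a₀-trap a₀y₀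
        a₁-trap : Trap a₁
        a₁-trap = proj₁ a₀-answer
        shrinks : ∀ {a b} → T (E₂ a b) → T (E a b)
        shrinks t = del-sub E a₀ y₀ (del-sub E₁ y₀ a₁ t)
        answer : ∀ {y a} → Relay y → Trap a → T (E₂ a y) →
                 Trap (partner y a) × partner y (partner y a) ≡ a ×
                 partner y a ≢ a × T (E₂ y (partner y a))
        answer {y} {a} y-relay a-trap t
          with relay-answer inv y-relay a-trap (shrinks t)
        ... | b-trap , involution , b≢a , yb = b-trap , involution , b≢a , yb₂
          where
          -- If the edge y b were one of the two deleted edges, the involution
          -- would identify a with a₁ resp. a₀, whose edge to y₀ is deleted.
          ¬first : ¬ SameEdge a₀ y₀ y (partner y a)
          ¬first (inj₁ (refl , _)) = Relay∉Trap y-relay a₀-trap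
          ¬first (inj₂ (refl , b≡a₀)) =
            del-gone E₁ y₀ a₁ (inj₂ (trans (sym involution) (cong (partner y₀) b≡a₀) , refl)) t
          ¬second : ¬ SameEdge y₀ a₁ y (partner y a)
          ¬second (inj₁ (refl , b≡a₁)) =
            del-gone E a₀ y₀ (inj₁ (a≡a₀ , refl)) (del-sub E₁ y₀ a₁ t)
            where
            a≡a₀ : a ≡ a₀
            a≡a₀ = trans (sym involution) (trans (cong (partner y₀) b≡a₁) (proj₁ (proj₂ a₀-answer)))
          ¬second (inj₂ (y≡a₁ , _)) = Relay∉Trap y-relay (subst Trap (sym y≡a₁) a₁-trap)
          yb₂ : T (E₂ y (partner y a))
          yb₂ = del-keep E₁ y₀ a₁ (del-keep E a₀ y₀ yb ¬first) ¬second

      trap-loses-within : ∀ N E a → edgeCount E < N → Invariant E → Trap a → Lose E a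
      trap-loses-within zero    E a () inv a-trap
      trap-loses-within (suc N) E a (s≤s bound) inv a-trap = lose reply
        where
        reply : ∀ y → T (E a y) → ¬ Terminal (del E a y) y × Win (del E a y) y
        reply y ay with trap-move inv a-trap ay
        ... | y≢s , inj₁ y-fin = not-terminal , win s ys (inj₁ (inj₁ refl))
          where
          ys : T (del E a y y s)
          ys = del-keep-avoiding Trap E a y (inj₁ a-trap) (Finish∉Trap y-fin) s∉Trap
                 (finish-open inv y-fin)
          not-terminal : ¬ Terminal (del E a y) y
          not-terminal (inj₁ y≡s)      = y≢s y≡s
          not-terminal (inj₂ isolated) = isolated s ys
        ... | y≢s , inj₂ y-relay with relay-answer inv y-relay a-trap ay
        ... | b-trap , _ , b≢a , yb = not-terminal , win b yb₁ (inj₂ b-loses)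
          where
          b = partner y a
          yb₁ : T (del E a y y b)
          yb₁ = del-keep E a y yb λ where
            (inj₁ (y≡a , _)) → Relay∉Trap y-relay (subst Trap (sym y≡a) a-trap)
            (inj₂ (_ , b≡a)) → b≢a b≡a
          not-terminal : ¬ Terminal (del E a y) y
          not-terminal (inj₁ y≡s)      = y≢s y≡s
          not-terminal (inj₂ isolated) = isolated b yb₁
          fewer : edgeCount (del (del E a y) y b) < edgeCount E
          fewer = ≤-<-trans (edgeCount-mono (del E a y) _ (del-sub (del E a y) y b))
                            (edgeCount-del E a y ay)
          b-loses : Lose (del (del E a y) y b) b
          b-loses = trap-loses-within N _ b (<-≤-trans fewer bound)
                      (invariant-step inv a-trap y-relay ay) b-trap

      trap-loses : ∀ {E a} → Invariant E → Trap a → Lose E a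
      trap-loses {E} {a} = trap-loses-within (suc (edgeCount E)) E a ≤-refl

pattern cu = zero
pattern cv = suc zero
pattern cw = suc (suc zero)

data Residue : Set where
  r0 r1 r2 : Residue

next : Residue → Residue
next r0 = r1
next r1 = r2
next r2 = r0

next-injective : ∀ {r r′} → next r ≡ next r′ → r ≡ r′
next-injective {r0} {r0} _ = refl
next-injective {r1} {r1} _ = refl
next-injective {r2} {r2} _ = refl

mod3 : ℕ → Residue
mod3 zero    = r0
mod3 (suc ℓ) = next (mod3 ℓ)

mod3-3* : ∀ k → mod3 (3 * k) ≡ r0
mod3-3* zero = refl
mod3-3* (suc k) = begin
  mod3 (3 * suc k)                  ≡⟨ cong mod3 (*-suc 3 k) ⟩
  next (next (next (mod3 (3 * k)))) ≡⟨ cong (next ∘ next ∘ next) (mod3-3* k) ⟩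
  r0                                ∎
  where open ≡-Reasoning

Trap : Fin 3 → ℕ → Set
Trap cu ℓ = mod3 ℓ ≡ r1
Trap cv ℓ = ⊥
Trap cw ℓ = mod3 ℓ ≡ r0

trap-unique : ∀ {c c′ ℓ} → Trap c ℓ → Trap c′ ℓ → c ≡ c′
trap-unique {cu} {cu} _ _ = refl
trap-unique {cw} {cw} _ _ = refl
trap-unique {cu} {cw} t t′ with trans (sym t) t′
... | ()
trap-unique {cw} {cu} t t′ with trans (sym t) t′
... | ()

data Adj : Fin 3 → ℕ → Fin 3 → ℕ → Set where
  same : ∀ {a b ℓ} → a ≢ b → Adj a ℓ b ℓ
  up   : ∀ {a b ℓ} → T (cross a b) → Adj a ℓ b (suc ℓ)
  down : ∀ {a b ℓ} → T (cross b a) → Adj a (suc ℓ) b ℓ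

no-trap-step : ∀ {a b ℓ} → Trap a ℓ → Trap b (suc ℓ) → ¬ T (cross a b)
no-trap-step {cu} {cu} t t′ with trans (sym (cong next t)) t′
... | ()
no-trap-step {cu} {cw} t t′ with trans (sym (cong next t)) t′
... | ()
no-trap-step {cw} {cw} t t′ with trans (sym (cong next t)) t′
... | ()
no-trap-step {cw} {cu} t t′ ()

traps-independent : ∀ {a b ℓ m} → Trap a ℓ → Trap b m → ¬ Adj a ℓ b m
traps-independent t t′ (same a≢b) = a≢b (trap-unique t t′)
traps-independent t t′ (up ab)    = no-trap-step t t′ ab
traps-independent t t′ (down ba)  = no-trap-step t′ t ba

cross-w : ∀ {d} → d ≢ cu → T (cross cw d)
cross-w {cu} d≢u = d≢u refl
cross-w {cv} _ = _
cross-w {cw} _ = _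

cross-w⁻¹ : ∀ {d} → T (cross cw d) → d ≢ cu
cross-w⁻¹ {cu} ()
cross-w⁻¹ {cv} _ ()
cross-w⁻¹ {cw} _ ()

cross-into-u : ∀ {d} → d ≢ cw → T (cross d cu)
cross-into-u {cu} _ = _
cross-into-u {cv} _ = _
cross-into-u {cw} d≢w = d≢w refl

cross-into-u⁻¹ : ∀ {d} → T (cross d cu) → d ≢ cw
cross-into-u⁻¹ {cu} _ ()
cross-into-u⁻¹ {cv} _ ()
cross-into-u⁻¹ {cw} ()

cross-u→into-w : ∀ {d} → T (cross cu d) → T (cross d cw)
cross-u→into-w {cu} _ = _
cross-u→into-w {cw} _ = _

cross-into-w→u : ∀ {d} → T (cross d cw) → T (cross cu d)
cross-into-w→u {cu} _ = _
cross-into-w→u {cw} _ = _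

-- The answer to a move from the trap (c , ℓ) to a relay on level m: the
-- other trap adjacent to that relay.  Along the chain of traps
-- w₀ u₁ w₃ u₄ … consecutive traps share their non-trap neighbours, and
-- from u_ℓ the relay leads to w_{ℓ+2} if it lies above ℓ, to w_{ℓ-1}
-- otherwise; symmetrically for w_ℓ.  (v is never a trap.)
partner : ℕ → Fin 3 → ℕ → Fin 3 × ℕ
partner m cu ℓ = if m ≡ᵇ suc ℓ then (cw , suc (suc ℓ)) else (cw , ℓ ∸ 1)
partner m cv ℓ = (cv , ℓ)
partner m cw ℓ = if suc m ≡ᵇ ℓ then (cu , ℓ ∸ 2) else (cu , suc ℓ)

partner-u-above : ∀ ℓ → partner (suc ℓ) cu ℓ ≡ (cw , suc (suc ℓ))
partner-u-above ℓ rewrite to T-≡ (≡⇒≡ᵇ ℓ ℓ refl) = refl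

partner-u-other : ∀ m ℓ → m ≢ suc ℓ → partner m cu ℓ ≡ (cw , ℓ ∸ 1)
partner-u-other m ℓ m≢ rewrite to T-not-≡ (T-not (m≢ ∘ ≡ᵇ⇒≡ m (suc ℓ))) = refl

partner-w-below : ∀ m → partner m cw (suc m) ≡ (cu , m ∸ 1)
partner-w-below m rewrite to T-≡ (≡⇒≡ᵇ m m refl) = refl

partner-w-other : ∀ m ℓ → suc m ≢ ℓ → partner m cw ℓ ≡ (cu , suc ℓ)
partner-w-other m ℓ m≢ rewrite to T-not-≡ (T-not (m≢ ∘ ≡ᵇ⇒≡ (suc m) ℓ)) = refl

module TrapsBelow (Q : ℕ) (Q-trap : mod3 Q ≡ r1) where

  -- A level that is not ≡ 1 (mod 3) cannot be Q.
  below-Q : ∀ {ℓ r} → mod3 ℓ ≡ r → r ≢ r1 → ℓ ≤ Q → suc ℓ ≤ Q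
  below-Q mod3ℓ r≢r1 ℓ≤Q =
    ≤∧≢⇒< ℓ≤Q λ ℓ≡Q → r≢r1 (trans (sym mod3ℓ) (trans (cong mod3 ℓ≡Q) Q-trap))

  trap-neighbour : ∀ {c ℓ d m} → Trap c ℓ → ℓ ≤ Q → Adj c ℓ d m →
                   m ≤ Q ⊎ (c ≡ cu × ℓ ≡ Q × m ≡ suc Q × T (cross cu d))
  trap-neighbour t ℓ≤Q (same _)  = inj₁ ℓ≤Q
  trap-neighbour t ℓ≤Q (down _)  = inj₁ (≤-trans (n≤1+n _) ℓ≤Q)
  trap-neighbour t ℓ≤Q (up cd) with m≤n⇒m<n∨m≡n ℓ≤Q
  ... | inj₁ ℓ<Q = inj₁ ℓ<Q
  ... | inj₂ refl with trap-unique {c′ = cu} t Q-trap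
  ... | refl = inj₂ (refl , refl , refl , cd)

  data Paired (m : ℕ) (c : Fin 3) (ℓ : ℕ) (d : Fin 3) : Fin 3 × ℕ → Set where
    paired : ∀ {c′ ℓ′} → Trap c′ ℓ′ → ℓ′ ≤ Q → partner m c′ ℓ′ ≡ (c , ℓ) → c′ ≢ c →
             Adj d m c′ ℓ′ → Paired m c ℓ d (c′ , ℓ′)

  relay-partner : ∀ {c ℓ d m} → Trap c ℓ → ℓ ≤ Q → m ≤ Q → Adj c ℓ d m →
                  Paired m c ℓ d (partner m c ℓ)
  relay-partner {cu} {suc ℓ} t ℓ≤Q m≤Q (same u≢d)
    rewrite partner-u-other (suc ℓ) (suc ℓ) (m≢1+n+m (suc ℓ) {0}) =
    paired (next-injective t) (≤-trans (n≤1+n ℓ) ℓ≤Q)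
           (partner-w-other (suc ℓ) ℓ (≢-sym (m≢1+n+m ℓ {1}))) (λ ())
           (down (cross-w (≢-sym u≢d)))
  relay-partner {cu} {ℓ} t ℓ≤Q m≤Q (up ud) rewrite partner-u-above ℓ =
    paired (cong (next ∘ next) t) (below-Q (cong next t) (λ ()) m≤Q)
           (partner-w-below (suc ℓ)) (λ ()) (up (cross-u→into-w ud))
  relay-partner {cu} {suc m} t ℓ≤Q m≤Q (down du)
    rewrite partner-u-other m (suc m) (m≢1+n+m m {1}) =
    paired (next-injective t) (≤-trans (n≤1+n m) ℓ≤Q)
           (partner-w-other m m 1+n≢n) (λ ()) (same (cross-into-u⁻¹ du))
  relay-partner {cw} {ℓ} t ℓ≤Q m≤Q (same w≢d) rewrite partner-w-other ℓ ℓ 1+n≢n =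
    paired (cong next t) (below-Q t (λ ()) ℓ≤Q)
           (partner-u-other ℓ (suc ℓ) (m≢1+n+m ℓ {1})) (λ ())
           (up (cross-into-u (≢-sym w≢d)))
  relay-partner {cw} {ℓ} t ℓ≤Q m≤Q (up wd)
    rewrite partner-w-other (suc ℓ) ℓ (≢-sym (m≢1+n+m ℓ {1})) =
    paired (cong next t) (below-Q t (λ ()) ℓ≤Q)
           (partner-u-other (suc ℓ) (suc ℓ) (m≢1+n+m (suc ℓ) {0})) (λ ())
           (same (cross-w⁻¹ wd))
  relay-partner {cw} {suc zero} () ℓ≤Q m≤Q (down dw)
  relay-partner {cw} {suc (suc m)} t ℓ≤Q m≤Q (down dw) rewrite partner-w-below (suc m) =
    paired (next-injective (next-injective t)) (≤-trans (n≤1+n m) (≤-trans (n≤1+n _) ℓ≤Q))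
           (partner-u-above m) (λ ()) (down (cross-into-w→u dw))

module OctahedralPath (n : ℕ) where

  level : OVertex n → ℕ
  level (_ , i) = toℕ i

  vertex-≡ : ∀ {c c′ : Fin 3} {i j : Fin (suc n)} →
             c ≡ c′ → toℕ i ≡ toℕ j → (c , i) ≡ (c′ , j)
  vertex-≡ refl i≡j = cong (_ ,_) (toℕ-injective i≡j)

  -- The level index ℓ, truncated to 0 outside {0..n}.
  index : ℕ → Fin (suc n)
  index ℓ with ℓ <? suc n
  ... | yes ℓ<1+n = fromℕ< ℓ<1+n
  ... | no  _     = zero

  at : Fin 3 → ℕ → OVertex n
  at c ℓ = c , index ℓ

  atPair : Fin 3 × ℕ → OVertex n
  atPair (c , ℓ) = at c ℓ

  level-at : ∀ {ℓ} → ℓ ≤ n → toℕ (index ℓ) ≡ ℓ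
  level-at {ℓ} ℓ≤n with ℓ <? suc n
  ... | yes ℓ<1+n = toℕ-fromℕ< ℓ<1+n
  ... | no  ℓ≮1+n = ⊥-elim (ℓ≮1+n (s≤s ℓ≤n))

  at-level : ∀ c i → at c (toℕ i) ≡ (c , i)
  at-level c i with toℕ i <? suc n
  ... | yes i<1+n = cong (c ,_) (fromℕ<-toℕ i i<1+n)
  ... | no  i≮1+n = ⊥-elim (i≮1+n (toℕ<n i))

  adj-elim : ∀ {a b i j} → T (octaEdge n (a , i) (b , j)) → Adj a (toℕ i) b (toℕ j)
  adj-elim {a} {b} {i} {j} t with to T-∨ t
  ... | inj₁ t₁ =
    let (i≡j , a≢b) = to T-∧ t₁
    in subst (Adj a (toℕ i) b) (≡ᵇ⇒≡ _ _ i≡j)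
         (same λ a≡b → T-not⁻¹ a≢b (≡⇒≡ᵇ (toℕ a) (toℕ b) (cong toℕ a≡b)))
  ... | inj₂ t₂ with to T-∨ t₂
  ... | inj₁ t₃ = let (j≡1+i , ab) = to T-∧ t₃ in
                  subst (Adj a (toℕ i) b) (≡ᵇ⇒≡ _ _ j≡1+i) (up ab)
  ... | inj₂ t₄ = let (i≡1+j , ba) = to T-∧ t₄ in
                  subst (λ ℓ → Adj a ℓ b (toℕ j)) (≡ᵇ⇒≡ _ _ i≡1+j) (down ba)

  adj-intro : ∀ {a b i j ℓ m} → toℕ i ≡ ℓ → toℕ j ≡ m → Adj a ℓ b m →
              T (octaEdge n (a , i) (b , j))
  adj-intro {a} {b} {i} {j} i≡ℓ j≡ℓ (same a≢b) = from T-∨ (inj₁ (from T-∧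
    (≡⇒≡ᵇ _ _ (trans i≡ℓ (sym j≡ℓ)) ,
     T-not λ t → a≢b (toℕ-injective (≡ᵇ⇒≡ (toℕ a) (toℕ b) t)))))
  adj-intro {a} {b} {i} {j} i≡ℓ j≡1+ℓ (up ab) = from (T-∨ {finEqᵇ i j ∧ not (finEqᵇ a b)})
    (inj₂ (from T-∨ (inj₁ (from T-∧ (≡⇒≡ᵇ _ _ (trans (cong suc i≡ℓ) (sym j≡1+ℓ)) , ab)))))
  adj-intro {a} {b} {i} {j} i≡1+m j≡m (down ba) = from (T-∨ {finEqᵇ i j ∧ not (finEqᵇ a b)})
    (inj₂ (from (T-∨ {(suc (toℕ i) ≡ᵇ toℕ j) ∧ cross a b})
      (inj₂ (from T-∧ (≡⇒≡ᵇ _ _ (trans (cong suc j≡m) (sym i≡1+m)) , ba)))))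

module Game (n k : ℕ) (h : 3 * k + 2 ≤ n) where

  open OctahedralPath n

  Q : ℕ
  Q = suc (3 * k)

  open TrapsBelow Q (cong next (mod3-3* k))

  Q≤n : Q ≤ n
  Q≤n = ≤-trans (n≤1+n Q) (subst (_≤ n) (+-comm (3 * k) 2) h)

  s : OVertex n
  s = uVertex n (3 * k + 2) (s≤s h)

  level-s : level s ≡ suc Q
  level-s = trans (toℕ-fromℕ< (s≤s h)) (+-comm (3 * k) 2)

  top-level : ∀ {ℓ} → ℓ ≡ suc Q → ¬ ℓ ≤ Q
  top-level refl = 1+n≰n

  below-s : ∀ {y} → level y ≤ Q → y ≢ s
  below-s y≤Q refl = top-level level-s y≤Q

  open FeedbackGame (_≟V_ {n}) s
  open PairingStrategy (_≟V_ {n}) s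

  x₁ : OVertex n
  x₁ = at cu Q

  E₁ : Graph
  E₁ = del (octaEdge n) s x₁

  E₁⊆E : ∀ {a b} → T (E₁ a b) → T (octaEdge n a b)
  E₁⊆E {a} {b} = del-sub (octaEdge n) s x₁ {a} {b}

  IsTrap IsRelay IsFinish : OVertex n → Set
  IsTrap a   = level a ≤ Q × Trap (proj₁ a) (level a)
  IsRelay y  = level y ≤ Q × ¬ IsTrap y
  IsFinish y = proj₁ y ≡ cw × level y ≡ suc Q

  answer : OVertex n → OVertex n → OVertex n
  answer y a = atPair (partner (level y) (proj₁ a) (level a))

  at-trap : ∀ c {ℓ} → ℓ ≤ Q → Trap c ℓ → IsTrap (at c ℓ)
  at-trap c ℓ≤Q t =
    subst (λ ℓ → ℓ ≤ Q × Trap c ℓ) (sym (level-at (≤-trans ℓ≤Q Q≤n))) (ℓ≤Q , t)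

  x₁-trap : IsTrap x₁
  x₁-trap = at-trap cu ≤-refl (cong next (mod3-3* k))

  relay-edge : ∀ {y b} → IsRelay y → T (octaEdge n y b) → T (E₁ y b)
  relay-edge {y} {b} (y≤Q , ¬trap) t = del-keep (octaEdge n) s x₁ {y} {b} t λ where
    (inj₁ (y≡s , _))  → below-s y≤Q y≡s
    (inj₂ (y≡x₁ , _)) → ¬trap (subst IsTrap (sym y≡x₁) x₁-trap)

  -- The three clauses of the pairing invariant for E₁.  From a trap Bob
  -- can reach only relays and w_{Q+1}; the edge u_Q s is already deleted.
  trap-move : ∀ {a y} → IsTrap a → T (E₁ a y) → y ≢ s × (IsFinish y ⊎ IsRelay y)
  trap-move {c , i} {d , j} (ℓ≤Q , t) ay with adj-elim (E₁⊆E {c , i} {d , j} ay)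
  ... | adj with trap-neighbour t ℓ≤Q adj
  ... | inj₁ m≤Q = below-s m≤Q , inj₂ (m≤Q , λ (_ , t′) → traps-independent t t′ adj)
  ... | inj₂ (refl , ℓ≡Q , m≡1+Q , ud) with d
  ... | cw = (λ ()) , inj₁ (refl , m≡1+Q)
  ... | cu = ⊥-elim (del-gone (octaEdge n) s x₁ (inj₂ (a≡x₁ , y≡s)) ay)
    where
    a≡x₁ : (cu , i) ≡ x₁
    a≡x₁ = vertex-≡ refl (trans ℓ≡Q (sym (level-at Q≤n)))
    y≡s : (cu , j) ≡ s
    y≡s = vertex-≡ refl (trans m≡1+Q (sym level-s))

  relay-answer : ∀ {y a} → IsRelay y → IsTrap a → T (E₁ a y) →
                 IsTrap (answer y a) × answer y (answer y a) ≡ a ×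
                 answer y a ≢ a × T (E₁ y (answer y a))
  relay-answer {d , j} {c , i} relay@(m≤Q , _) (ℓ≤Q , t) ay
    with partner (toℕ j) c (toℕ i)
       | relay-partner t ℓ≤Q m≤Q (adj-elim (E₁⊆E {c , i} {d , j} ay))
  ... | c′ , ℓ′ | paired t′ ℓ′≤Q back c′≢c adj′ =
    at-trap c′ ℓ′≤Q t′ , involution , (λ e → c′≢c (cong proj₁ e)) ,
    relay-edge relay (adj-intro {d} {c′} {j} refl (level-at ℓ′≤n) adj′)
    where
    ℓ′≤n : ℓ′ ≤ n
    ℓ′≤n = ≤-trans ℓ′≤Q Q≤n
    involution : answer (d , j) (at c′ ℓ′) ≡ (c , i)
    involution = begin
      answer (d , j) (at c′ ℓ′)      ≡⟨ cong (atPair ∘ partner (toℕ j) c′) (level-at ℓ′≤n) ⟩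
      atPair (partner (toℕ j) c′ ℓ′) ≡⟨ cong atPair back ⟩
      at c (toℕ i)                   ≡⟨ at-level c i ⟩
      (c , i)                        ∎
      where open ≡-Reasoning

  finish-open : ∀ {d} → IsFinish d → T (E₁ d s)
  finish-open {cw , j} (refl , m≡1+Q) =
    del-keep (octaEdge n) s x₁ {cw , j} {s}
      (adj-intro {cw} {cu} {j} m≡1+Q level-s (same (λ ()))) λ where
      (inj₁ (() , _))
      (inj₂ (() , _))

  open EdgeCount (cartesianProduct (allFin 3) (allFin (suc n)))
                 (λ (c , i) → ∈-cartesianProduct⁺ (∈-allFin c) (∈-allFin i))
  open Strategy IsTrap IsRelay IsFinish answer
                (λ (s≤Q , _) → top-level level-s s≤Q)
                (λ (_ , d≡1+Q) (d≤Q , _) → top-level d≡1+Q d≤Q)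
                proj₂

  invariant : Invariant E₁
  invariant = record { trap-move = trap-move ; relay-answer = relay-answer
                     ; finish-open = finish-open }

  alice-wins : AliceWins (octaEdge n)
  alice-wins = win x₁ s-x₁ (inj₂ (trap-loses invariant x₁-trap))
    where
    s-x₁ : T (octaEdge n s x₁)
    s-x₁ = adj-intro {cu} {cu} level-s (level-at Q≤n) (down _)

lemma3p4 : (n k : ℕ) → 1 ≤ n → (h : 3 * k + 2 ≤ n) →
    AliceWinsOcta n (uVertex n (3 * k + 2) (s≤s h))
lemma3p4 n k _ h = Game.alice-wins n k h
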